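{- Let $T$ be a rooted tree over a vertex set $V$, let $d$ be a positive integer, and suppose $B\subseteq V$ is a $(T,d)$-blocker set. Then for any $v\in V(T)$, the tree path from the root of $T$ to $v$ is $(B,2d)$-covered.
   Context: Here $T$ may have arbitrary depth. $B$ is a $(T,d)$-blocker set if for every non-leaf vertex $x$ of $T$ whose depth (number of edges from the root) is divisible by $d$, and every descendant $y$ of $x$ of depth $\mathrm{depth}(x)+d$, some vertex of the tree path from $x$ to $y$ (inclusive) belongs to $B$. A path $P$ is $(B,k)$-covered if $P=P_1\cdots P_r$ with $P_i$ a $u_i\to v_i$ path with at most $k$ edges and $u_i\in B$ for all $i\ge2$. -}

module Defs where

open import Data.Nat using (ℕ; zero; suc; _+_; _≤_; _<_)
open import Data.Nat.Divisibility using (_∣_)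
open import Data.List using (List; []; _∷_; _++_; [_]; concat; map; length)
open import Data.List.NonEmpty as L⁺ using (List⁺)
open import Data.List.Relation.Unary.Any using (Any)
open import Data.List.Relation.Unary.All using (All)
open import Data.List.Relation.Unary.Linked using (Linked)
open import Data.Product using (Σ; ∃; ∃-syntax; _×_)
open import Relation.Binary.PropositionalEquality using (_≡_)
open import Relation.Unary using (Pred)
open import Level using (0ℓ)

-- The parent of the
-- root is irrelevant.  Every vertex of depth n+1 has a parent of depth n,
-- and the only vertex of depth 0 is the root; hence following parents from
-- any vertex reaches the root in exactly (depth v) steps (connected, acyclic).
record RootedTree (V : Set) : Set where
  field
    root         : V
    parent       : V → V
    depth        : V → ℕ
    depth-root   : depth root ≡ 0
    depth-parent : ∀ v n → depth v ≡ suc n → depth (parent v) ≡ n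
    depth-zero   : ∀ v → depth v ≡ 0 → v ≡ root

module _ {V : Set} (T : RootedTree V) where
  open RootedTree T

  ancestor : ℕ → V → V
  ancestor zero    v = v
  ancestor (suc n) v = ancestor n (parent v)

  pathUp : ℕ → V → List V
  pathUp zero    v = [ v ]
  pathUp (suc n) v = pathUp n (parent v) ++ [ v ]

  rootPath : V → List V
  rootPath v = pathUp (depth v) v

  IsDescendant : V → V → Set
  IsDescendant y x = Σ ℕ λ n → depth y ≡ n + depth x × ancestor n y ≡ x

  IsNonLeaf : V → Set
  IsNonLeaf x = ∃[ c ] (parent c ≡ x × depth c ≡ suc (depth x))

  IsBlocker : Pred V 0ℓ → ℕ → Set
  IsBlocker B d =
    ∀ x y → IsNonLeaf x → d ∣ depth x →
      IsDescendant y x → depth y ≡ depth x + d →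
      Any B (pathUp d y)   -- the tree path from x to y, inclusive

-- Concatenation P₁ ⋯ Pᵣ of paths (vertex sequences) in which the end of Pᵢ
-- is the start of Pᵢ₊₁: the shared vertex is listed once.
glue : {V : Set} → List⁺ (List⁺ V) → List V
glue (s L⁺.∷ ss) = L⁺.toList s ++ concat (map L⁺.tail ss)

Covered : {V : Set} → Pred V 0ℓ → ℕ → List V → Set
Covered {V} B k P =
  Σ (List⁺ (List⁺ V)) λ segs →
      P ≡ glue segs
    × All (λ s → L⁺.length s ≤ suc k) (L⁺.toList segs)        -- each Pᵢ has ≤ k edges
    × Linked (λ s t → L⁺.last s ≡ L⁺.head t) (L⁺.toList segs)
    × All (λ s → B (L⁺.head s)) (List⁺.tail segs)

-- Cut the depth of v as r + j·d with r ≤ d.  While j ≥ 2, the ancestor y of v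
-- at depth j·d and its ancestor x at depth (j-1)·d are a blocker pair, so some
-- b ∈ B lies between them; the path b → v has at most r + d ≤ 2d edges and b
-- has depth t + (j-1)·d with t ≤ d, so we recurse on b.  Once j ≤ 1 the
-- remaining root path has at most 2d edges and forms the first segment.
module Submission where

open import Defs
open import Data.Nat using (ℕ; NonZero; >-nonZero; _<_; _*_; zero; suc; _+_; _≤_; s≤s; z≤n)
open import Data.Nat.Properties
  using (+-assoc; +-comm; +-suc; ≤-trans; <⇒≤; m≤m+n; m≤n+m; +-mono-≤; +-monoˡ-≤)
open import Data.Nat.Divisibility using (_∣_; n∣m*n)
open import Data.Nat.DivMod using (_/_; _%_; m≡m%n+[m/n]*n; m%n<n)
open import Data.List using (List; []; _∷_; _++_; [_]; _∷ʳ_; concat; map; initLast; _∷ʳ′_)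
open import Data.List.Properties using (++-identityʳ; ++-assoc; length-++-comm)
open import Data.List.NonEmpty as L⁺ using (List⁺)
open import Data.List.Relation.Unary.Any using (Any; here)
open import Data.List.Relation.Unary.Any.Properties using (++⁻)
open import Data.List.Relation.Unary.All using (All; []; _∷_)
open import Data.List.Relation.Unary.Linked using (Linked; [-]; _∷_)
open import Data.Product using (Σ; _×_; _,_)
open import Data.Sum using (inj₁; inj₂)
open import Relation.Binary.PropositionalEquality using (_≡_; refl; sym; trans; cong; subst; module ≡-Reasoning)
open import Relation.Unary using (Pred)
open import Level using (0ℓ)

initLast-∷ʳ : {A : Set} (xs : List A) (x : A) → initLast (xs ∷ʳ x) ≡ xs ∷ʳ′ x
initLast-∷ʳ []       x = refl
initLast-∷ʳ (y ∷ ys) x rewrite initLast-∷ʳ ys x = refl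

last-∷ʳ : {A : Set} (y : A) (xs : List A) (x : A) → L⁺.last (y L⁺.∷ xs ∷ʳ x) ≡ x
last-∷ʳ y xs x rewrite initLast-∷ʳ xs x = refl

module _ {V : Set} (B : Pred V 0ℓ) (k : ℕ) where

  -- The segments P₂ ⋯ Pᵣ of a (B,k)-covering whose first segment ends at e.
  data CoveringFrom : V → List (List⁺ V) → Set where
    []  : ∀ {e} → CoveringFrom e []
    _∷_ : ∀ {e s ss} → L⁺.head s ≡ e × L⁺.length s ≤ suc k × B (L⁺.head s) →
          CoveringFrom (L⁺.last s) ss → CoveringFrom e (s ∷ ss)

  glue-covered : ∀ {s ss} → L⁺.length s ≤ suc k → CoveringFrom (L⁺.last s) ss →
                 Covered B k (glue (s L⁺.∷ ss))
  glue-covered {s} {ss} s≤ c = s L⁺.∷ ss , refl , s≤ ∷ lengths c , linked c , heads c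
    where
    lengths : ∀ {e ss} → CoveringFrom e ss → All (λ s → L⁺.length s ≤ suc k) ss
    lengths []                  = []
    lengths ((_ , ≤k , _) ∷ c) = ≤k ∷ lengths c

    heads : ∀ {e ss} → CoveringFrom e ss → All (λ s → B (L⁺.head s)) ss
    heads []                 = []
    heads ((_ , _ , b) ∷ c) = b ∷ heads c

    linked : ∀ {s ss} → CoveringFrom (L⁺.last s) ss →
             Linked (λ s t → L⁺.last s ≡ L⁺.head t) (s ∷ ss)
    linked []                  = [-]
    linked ((h≡ , _ , _) ∷ c) = sym h≡ ∷ linked c

module Tree {V : Set} (T : RootedTree V) where
  open RootedTree T

  tailUp : ℕ → V → List V
  tailUp zero    v = []
  tailUp (suc n) v = tailUp n (parent v) ∷ʳ v

  segment : ℕ → V → List⁺ V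
  segment n v = ancestor T n v L⁺.∷ tailUp n v

  pathUp-segment : ∀ n v → pathUp T n v ≡ L⁺.toList (segment n v)
  pathUp-segment zero    v = refl
  pathUp-segment (suc n) v = cong (_∷ʳ v) (pathUp-segment n (parent v))

  length-segment : ∀ n v → L⁺.length (segment n v) ≡ suc n
  length-segment zero    v = refl
  length-segment (suc n) v =
    trans (cong suc (length-++-comm (tailUp n (parent v)) [ v ])) (cong suc (length-segment n (parent v)))

  last-segment : ∀ n v → L⁺.last (segment n v) ≡ v
  last-segment zero    v = refl
  last-segment (suc n) v = last-∷ʳ _ (tailUp n (parent v)) v

  pathUp-+ : ∀ n m v → pathUp T (n + m) v ≡ pathUp T m (ancestor T n v) ++ tailUp n v
  pathUp-+ zero    m v = sym (++-identityʳ _)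
  pathUp-+ (suc n) m v = trans (cong (_∷ʳ v) (pathUp-+ n m (parent v)))
                               (++-assoc (pathUp T m (ancestor T n (parent v))) (tailUp n (parent v)) [ v ])

  depth-ancestor : ∀ n m v → depth v ≡ n + m → depth (ancestor T n v) ≡ m
  depth-ancestor zero    m v eq = eq
  depth-ancestor (suc n) m v eq = depth-ancestor n m (parent v) (depth-parent v (n + m) eq)

  rootPath-++ : ∀ n m v xs → depth v ≡ n + m →
                rootPath T v ++ xs ≡ rootPath T (ancestor T n v) ++ (tailUp n v ++ xs)
  rootPath-++ n m v xs eq = begin
    pathUp T (depth v) v ++ xs                        ≡⟨ cong (λ l → pathUp T l v ++ xs) eq ⟩
    pathUp T (n + m) v ++ xs                          ≡⟨ cong (_++ xs) (pathUp-+ n m v) ⟩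
    (pathUp T m a ++ tailUp n v) ++ xs                ≡⟨ ++-assoc (pathUp T m a) (tailUp n v) xs ⟩
    pathUp T m a ++ (tailUp n v ++ xs)                ≡⟨ cong (λ l → pathUp T l a ++ (tailUp n v ++ xs))
                                                              (sym (depth-ancestor n m v eq)) ⟩
    rootPath T a ++ (tailUp n v ++ xs)                ∎
    where
    open ≡-Reasoning
    a = ancestor T n v

  parent-ancestor : ∀ n v → parent (ancestor T n v) ≡ ancestor T n (parent v)
  parent-ancestor zero    v = refl
  parent-ancestor (suc n) v = parent-ancestor n (parent v)

  ancestor-+ : ∀ n m v → ancestor T m (ancestor T n v) ≡ ancestor T (n + m) v
  ancestor-+ zero    m v = refl
  ancestor-+ (suc n) m v = ancestor-+ n m (parent v)

  any-pathUp : ∀ {P : Pred V 0ℓ} n v → Any P (pathUp T n v) →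
               Σ ℕ λ m → Σ ℕ λ t → n ≡ m + t × P (ancestor T m v)
  any-pathUp zero    v (here p) = 0 , 0 , refl , p
  any-pathUp (suc n) v p with ++⁻ (pathUp T n (parent v)) p
  ... | inj₂ (here p′) = 0 , suc n , refl , p′
  ... | inj₁ p′ with any-pathUp n (parent v) p′
  ...   | m , t , n≡m+t , p″ = suc m , t , cong suc n≡m+t , p″

  ancestor-isNonLeaf : ∀ n m v → 0 < n → depth v ≡ n + m → IsNonLeaf T (ancestor T n v)
  ancestor-isNonLeaf (suc n) m v _ eq =
    ancestor T n v , parent-ancestor n v ,
    trans (depth-ancestor n (suc m) v (trans eq (sym (+-suc n m))))
          (cong suc (sym (depth-ancestor (suc n) m v eq)))

  module _ {B : Pred V 0ℓ} {k : ℕ} where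

    segment-covering : ∀ n v {ss} → n ≤ k → B (ancestor T n v) → CoveringFrom B k v ss →
                       CoveringFrom B k (ancestor T n v) (segment n v ∷ ss)
    segment-covering n v n≤k b c =
      (refl , subst (_≤ suc k) (sym (length-segment n v)) (s≤s n≤k) , b) ∷
      subst (λ e → CoveringFrom B k e _) (sym (last-segment n v)) c

    rootPath-covered : ∀ v {ss} → depth v ≤ k → CoveringFrom B k v ss →
                       Covered B k (rootPath T v ++ concat (map L⁺.tail ss))
    rootPath-covered v {ss} depth≤k c =
      subst (λ P → Covered B k (P ++ concat (map L⁺.tail ss))) (sym (pathUp-segment (depth v) v))
        (glue-covered B k (subst (_≤ suc k) (sym (length-segment (depth v) v)) (s≤s depth≤k))
                          (subst (λ e → CoveringFrom B k e ss) (sym (last-segment (depth v) v)) c))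

module _ {V : Set} (T : RootedTree V) (d : ℕ) (0<d : 0 < d)
         (B : Pred V 0ℓ) (blocker : IsBlocker T B d) where
  open RootedTree T
  open Tree T

  blocker-ancestor : ∀ j r v → r ≤ d → depth v ≡ r + suc (suc j) * d →
                     Σ ℕ λ n → Σ ℕ λ t → n ≤ 2 * d × t ≤ d ×
                       depth v ≡ n + (t + suc j * d) × B (ancestor T n v)
  blocker-ancestor j r v r≤d eq =
    pick (any-pathUp d y (blocker x y x-nonLeaf d∣x (d , depth-y′ , refl) (trans depth-y′ (+-comm d (depth x)))))
    where
    X = suc j * d
    y = ancestor T r v
    x = ancestor T d y
    depth-y : depth y ≡ d + X
    depth-y = depth-ancestor r (d + X) v eq
    depth-x : depth x ≡ X
    depth-x = depth-ancestor d X y depth-y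
    depth-y′ : depth y ≡ d + depth x
    depth-y′ = trans depth-y (cong (d +_) (sym depth-x))
    x-nonLeaf : IsNonLeaf T x
    x-nonLeaf = ancestor-isNonLeaf d X y 0<d depth-y
    d∣x : d ∣ depth x
    d∣x = subst (d ∣_) (sym depth-x) (n∣m*n (suc j))

    pick : (Σ ℕ λ m → Σ ℕ λ t → d ≡ m + t × B (ancestor T m y)) →
           Σ ℕ λ n → Σ ℕ λ t → n ≤ 2 * d × t ≤ d × depth v ≡ n + (t + X) × B (ancestor T n v)
    pick (m , t , d≡m+t , b∈B) =
      r + m , t , +-mono-≤ r≤d (≤-trans m≤d (m≤m+n d 0)) ,
      subst (t ≤_) (sym d≡m+t) (m≤n+m t m) , depth-v , subst B (ancestor-+ r m v) b∈B
      where
      m≤d : m ≤ d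
      m≤d = subst (m ≤_) (sym d≡m+t) (m≤m+n m t)
      depth-v : depth v ≡ (r + m) + (t + X)
      depth-v = begin
        depth v           ≡⟨ eq ⟩
        r + (d + X)       ≡⟨ cong (λ e → r + (e + X)) d≡m+t ⟩
        r + (m + t + X)   ≡⟨ cong (r +_) (+-assoc m t X) ⟩
        r + (m + (t + X)) ≡⟨ sym (+-assoc r m (t + X)) ⟩
        r + m + (t + X)   ∎
        where open ≡-Reasoning

  covered-suffix : ∀ j r v {ss} → r ≤ d → depth v ≡ r + j * d → CoveringFrom B (2 * d) v ss →
                   Covered B (2 * d) (rootPath T v ++ concat (map L⁺.tail ss))
  covered-suffix zero          r v r≤d eq c =
    rootPath-covered v (subst (_≤ 2 * d) (sym eq) (+-mono-≤ r≤d z≤n)) c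
  covered-suffix (suc zero)    r v r≤d eq c =
    rootPath-covered v (subst (_≤ 2 * d) (sym eq) (+-monoˡ-≤ (d + 0) r≤d)) c
  covered-suffix (suc (suc i)) r v {ss} r≤d eq c =
    let n , t , n≤2d , t≤d , depth-v , b∈B = blocker-ancestor i r v r≤d eq
    in subst (Covered B (2 * d)) (sym (rootPath-++ n _ v (concat (map L⁺.tail ss)) depth-v))
         (covered-suffix (suc i) t (ancestor T n v) t≤d (depth-ancestor n _ v depth-v)
           (segment-covering n v n≤2d b∈B c))

mainTheorem17 : {V : Set} (T : RootedTree V) (d : ℕ) → 0 < d →
                (B : Pred V 0ℓ) → IsBlocker T B d →
                (v : V) → Covered B (2 * d) (rootPath T v)
mainTheorem17 T d 0<d B blocker v =
  subst (Covered B (2 * d)) (++-identityʳ (rootPath T v))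
    (covered-suffix T d 0<d B blocker (depth v / d) (depth v % d) v
       (<⇒≤ (m%n<n (depth v) d)) (m≡m%n+[m/n]*n (depth v) d) [])
  where
  open RootedTree T
  instance
    d≢0 : NonZero d
    d≢0 = >-nonZero 0<d
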